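{- If $W$ is a singleton world of $\mathrm{LO}^{\mathrm{mon}}$, then $\mathrm{Val}_{\mathrm{LO}^{\mathrm{mon}}}(W,\mathcal L^{\Diamond}_{\le}(W))=\mathsf{S5}$.
   Context: Linear orders are total orders, possibly empty. $\mathrm{LO}^{\mathrm{mon}}$ is the category of linear orders and monotone maps. $\mathcal L^{\Diamond}_{\le}(W)$ is the modal extension (operators $\Diamond,\Box$) of $\{\le\}$ with constants naming elements of $W$ (transported along morphisms). Modal satisfaction: $U\models\Diamond\varphi[\nu]$ iff there is a morphism $f:U\to V$ with $V\models\varphi[f\circ\nu]$; $\Box$ dually. $\mathrm{Val}(W,\Gamma)$ is the set of propositional modal formulas $\psi(p_0,\dots,p_n)$ all of whose substitution instances $\psi(\varphi_0,\dots,\varphi_n)$ with $\varphi_i\in\Gamma$ hold at $W$. $\mathsf{S5}$ is the normal modal logic axiomatized by $\Box p\to p$, $\Box p\to\Box\Box p$ and $\Diamond\Box p\to p$. -}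

module Defs where

open import Level using (Level; 0ℓ; Lift) renaming (suc to lsuc)
open import Data.Nat using (ℕ; zero; suc)
open import Data.Fin using (Fin; zero; suc)
open import Data.Empty using (⊥)
open import Data.Product using (Σ; _×_)
open import Function using (_∘_; id)
open import Relation.Nullary using (¬_)
open import Relation.Binary.Core using (Rel)
open import Relation.Binary.Structures using (IsTotalOrder)
open import Relation.Binary.PropositionalEquality using (_≡_)

-- The category LO^mon: linear orders (possibly empty) and monotone maps

record LinOrd : Set₁ where
  field
    Carrier      : Set
    _≤_          : Rel Carrier 0ℓ
    isTotalOrder : IsTotalOrder _≡_ _≤_

open LinOrd public

record Mono (U V : LinOrd) : Set where
  field
    fun  : Carrier U → Carrier V
    mono : ∀ {x y} → _≤_ U x y → _≤_ V (fun x) (fun y)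

open Mono public

IsSingleton : LinOrd → Set
IsSingleton W = Σ (Carrier W) λ w → ∀ (x : Carrier W) → x ≡ w

-- The language L^◇_≤(W): first-order language {≤} (with equality),
-- constants for the elements of a set A (A = Carrier W), closed under □.

data Term (A : Set) (n : ℕ) : Set where
  var   : Fin n → Term A n
  const : A → Term A n

data Fm (A : Set) : ℕ → Set where
  _≤ᶠ_ : ∀ {n} → Term A n → Term A n → Fm A n
  _≈ᶠ_ : ∀ {n} → Term A n → Term A n → Fm A n
  ⊥ᶠ   : ∀ {n} → Fm A n
  _⇒ᶠ_ : ∀ {n} → Fm A n → Fm A n → Fm A n
  ∀ᶠ   : ∀ {n} → Fm A (suc n) → Fm A n
  □ᶠ   : ∀ {n} → Fm A n → Fm A n

¬ᶠ_ : ∀ {A n} → Fm A n → Fm A n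
¬ᶠ φ = φ ⇒ᶠ ⊥ᶠ

◇ᶠ_ : ∀ {A n} → Fm A n → Fm A n
◇ᶠ φ = ¬ᶠ (□ᶠ (¬ᶠ φ))

Sentence : Set → Set
Sentence A = Fm A 0

extend : ∀ {X : Set} {n} → X → (Fin n → X) → Fin (suc n) → X
extend x ν zero    = x
extend x ν (suc i) = ν i

-- Satisfaction (classical, via the negative translation: atoms are
-- double-negated, so every clause is ¬¬-stable).
-- κ interprets the constants (the elements of W), ν the free variables.

module _ {A : Set} where

  evalT : ∀ {n} (U : LinOrd) → (A → Carrier U) → (Fin n → Carrier U) →
          Term A n → Carrier U
  evalT U κ ν (var i)   = ν i
  evalT U κ ν (const a) = κ a

  Sat : ∀ {n} (U : LinOrd) → (A → Carrier U) → (Fin n → Carrier U) →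
        Fm A n → Set₁
  Sat U κ ν (s ≤ᶠ t) = Lift (lsuc 0ℓ) (¬ ¬ (_≤_ U (evalT U κ ν s) (evalT U κ ν t)))
  Sat U κ ν (s ≈ᶠ t) = Lift (lsuc 0ℓ) (¬ ¬ (evalT U κ ν s ≡ evalT U κ ν t))
  Sat U κ ν ⊥ᶠ       = Lift (lsuc 0ℓ) ⊥
  Sat U κ ν (φ ⇒ᶠ χ) = Sat U κ ν φ → Sat U κ ν χ
  Sat U κ ν (∀ᶠ φ)   = ∀ (x : Carrier U) → Sat U κ (extend x ν) φ
  Sat U κ ν (□ᶠ φ)   = ∀ (V : LinOrd) (f : Mono U V) →
                         Sat V (fun f ∘ κ) (fun f ∘ ν) φ

_⊨_ : (W : LinOrd) → Sentence (Carrier W) → Set₁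
W ⊨ φ = Sat W id (λ ()) φ

data MFm : Set where
  pvar : ℕ → MFm
  ⊥ₘ   : MFm
  _⇒ₘ_ : MFm → MFm → MFm
  □ₘ   : MFm → MFm

¬ₘ_ : MFm → MFm
¬ₘ p = p ⇒ₘ ⊥ₘ

◇ₘ_ : MFm → MFm
◇ₘ p = ¬ₘ (□ₘ (¬ₘ p))

inst : ∀ {A} → (ℕ → Sentence A) → MFm → Sentence A
inst σ (pvar i) = σ i
inst σ ⊥ₘ       = ⊥ᶠ
inst σ (p ⇒ₘ q) = inst σ p ⇒ᶠ inst σ q
inst σ (□ₘ p)   = □ᶠ (inst σ p)

Val : LinOrd → MFm → Set₁
Val W ψ = ∀ (σ : ℕ → Sentence (Carrier W)) → W ⊨ inst σ ψ

-- S5: normal modal logic with T, 4, B (Hilbert system, axiom schemes,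
-- so closure under uniform substitution is built in).

data S5 : MFm → Set where
  ax-K   : ∀ p q → S5 (p ⇒ₘ (q ⇒ₘ p))
  ax-S   : ∀ p q r → S5 ((p ⇒ₘ (q ⇒ₘ r)) ⇒ₘ ((p ⇒ₘ q) ⇒ₘ (p ⇒ₘ r)))
  ax-DN  : ∀ p → S5 ((¬ₘ (¬ₘ p)) ⇒ₘ p)
  ax-□K  : ∀ p q → S5 (□ₘ (p ⇒ₘ q) ⇒ₘ (□ₘ p ⇒ₘ □ₘ q))
  ax-T   : ∀ p → S5 (□ₘ p ⇒ₘ p)
  ax-4   : ∀ p → S5 (□ₘ p ⇒ₘ □ₘ (□ₘ p))
  ax-B   : ∀ p → S5 ((◇ₘ (□ₘ p)) ⇒ₘ p)
  mp     : ∀ {p q} → S5 (p ⇒ₘ q) → S5 p → S5 q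
  nec    : ∀ {p} → S5 p → S5 (□ₘ p)

-- Soundness: the S5 axioms hold at every world of LO^mon for sentences whose
-- constants all denote one point; for B one returns from a world V to U along a
-- constant map, which preserves that point.
--
-- Completeness: for ψ in n variables, Kalmár's method decides between S5 ⊢ ψ and a
-- cluster countermodel. For a set C of valuations and a valuation v, the literals
-- of v together with ◇ char u (u ∈ C) and ¬ ◇ char u (u ∉ C) derive ψ or ¬ ψ
-- according to the value of ψ at v in the universal model C, and case analysis over
-- all these literals eliminates them. A countermodel (C, v) is realised in LO^mon:
-- listing C as v = u₀, u₁, …, u_m, substitute for p_i the sentence
-- "if |U| ≤ 1 then u₀(i) else if |U| ≤ 2 then u₁(i) else … u_m(i)". Classically
-- every linear order picks some u_j, each u_j is picked by a finite order reachable
-- from any world by a constant map, and the singleton W picks v. So □ acts as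
-- quantification over C, and the instance of ψ fails at W.

{-# OPTIONS --safe #-}
module Submission where

open import Data.Bool using (Bool; true; false; not; _∨_; T)
open import Data.Bool.ListAction using (all)
open import Data.Empty using (⊥; ⊥-elim)
open import Data.Fin using (Fin; zero; suc; toℕ; fromℕ<)
import Data.Fin as Fin
open import Data.Fin.Properties using (toℕ<n; toℕ-fromℕ<)
  renaming (≤-isTotalOrder to Fin-≤-isTotalOrder)
open import Data.List using (List; []; _∷_; _++_; map; [_])
open import Data.List.Membership.Propositional using (_∈_; find)
open import Data.List.Membership.Propositional.Properties
  using (∈-map⁺; ∈-map⁻; ∈-++⁺ˡ; ∈-++⁺ʳ; ∈-++⁻)
open import Data.List.Relation.Binary.Permutation.Propositional using (↭-sym)
open import Data.List.Relation.Binary.Permutation.Propositional.Properties using (shift)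
open import Data.List.Relation.Binary.Subset.Propositional using (_⊆_)
open import Data.List.Relation.Binary.Subset.Propositional.Properties
  using (xs⊆xs++ys; xs⊆ys++xs; ∷⁺ʳ; ⊆-reflexive-↭)
import Data.List.Relation.Unary.All as All
open import Data.List.Relation.Unary.All.Properties using (all⁺; all⁻; ¬All⇒Any¬)
open import Data.List.Relation.Unary.Any using (here; there)
open import Data.Nat using (ℕ; zero; suc; _<_; _≤_; _⊔_; _+_; s≤s)
open import Data.Nat.Properties
  using (+-suc; +-identityʳ; ≤-refl; ≤-trans; n≤1+n; m≤m⊔n; m≤n⊔m; m≤m+n; m≤n+m;
         ≤-<-trans; +-monoˡ-≤; ≰⇒>; <⇒≱; 1+n≰n; _<?_; module ≤-Reasoning)
open import Data.Product using (_×_; ∃; ∃₂; _,_)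
open import Data.Sum using (_⊎_; inj₁; inj₂; fromInj₁)
import Data.Sum as Sum
open import Data.Unit using (⊤; tt)
open import Data.Vec using (Vec; []; _∷_)
import Data.Vec as Vec
open import Data.Vec.Membership.Propositional using () renaming (_∈_ to _∈ᵥ_)
open import Data.Vec.Membership.Propositional.Properties using (∈-fromList⁺)
open import Data.Vec.Relation.Unary.Any using (here; there)
open import Function using (_∘_; _$_; id)
open import Level using (Lift; lift; lower; 0ℓ) renaming (suc to lsuc)
open import Relation.Binary.PropositionalEquality
  using (_≡_; _≗_; refl; sym; trans; cong; subst; subst₂)
open import Relation.Binary.Structures using (IsTotalOrder)
open import Relation.Nullary using (¬_)
open import Relation.Nullary.Decidable using (T?; decidable-stable)
open import Relation.Nullary.Reflects using (Reflects; ofʸ; ofⁿ; invert; _→-reflects_)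

open import Defs renaming (_≤_ to _≤ᴸ_)

infix  3 _⊢_
infixl 5 _·_

data _⊢_ (Γ : List MFm) : MFm → Set where
  hyp : ∀ {φ} → φ ∈ Γ → Γ ⊢ φ
  s5  : ∀ {φ} → S5 φ → Γ ⊢ φ
  _·_ : ∀ {φ ψ} → Γ ⊢ φ ⇒ₘ ψ → Γ ⊢ φ → Γ ⊢ ψ

closed⇒S5 : ∀ {φ} → [] ⊢ φ → S5 φ
closed⇒S5 (s5 p)  = p
closed⇒S5 (d · e) = mp (closed⇒S5 d) (closed⇒S5 e)

⊢-cut : ∀ {Γ Δ φ} → (∀ {χ} → χ ∈ Γ → Δ ⊢ χ) → Γ ⊢ φ → Δ ⊢ φ
⊢-cut Δ⊢Γ (hyp p) = Δ⊢Γ p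
⊢-cut Δ⊢Γ (s5 p)  = s5 p
⊢-cut Δ⊢Γ (d · e) = ⊢-cut Δ⊢Γ d · ⊢-cut Δ⊢Γ e

⊢-weaken : ∀ {Γ Δ φ} → Γ ⊆ Δ → Γ ⊢ φ → Δ ⊢ φ
⊢-weaken Γ⊆Δ = ⊢-cut (hyp ∘ Γ⊆Δ)

⊢-weaken₁ : ∀ {Γ χ φ} → Γ ⊢ φ → χ ∷ Γ ⊢ φ
⊢-weaken₁ = ⊢-weaken there

#0 : ∀ {Γ φ} → φ ∷ Γ ⊢ φ
#0 = hyp (here refl)

#1 : ∀ {Γ φ χ} → χ ∷ φ ∷ Γ ⊢ φ
#1 = hyp (there (here refl))

#2 : ∀ {Γ φ χ ξ} → ξ ∷ χ ∷ φ ∷ Γ ⊢ φ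
#2 = hyp (there (there (here refl)))

S5-refl : ∀ φ → S5 (φ ⇒ₘ φ)
S5-refl φ = mp (mp (ax-S φ (φ ⇒ₘ φ) φ) (ax-K φ (φ ⇒ₘ φ))) (ax-K φ φ)

⇒-intro : ∀ {Γ φ ψ} → φ ∷ Γ ⊢ ψ → Γ ⊢ φ ⇒ₘ ψ
⇒-intro (hyp (here refl)) = s5 (S5-refl _)
⇒-intro (hyp (there p))   = s5 (ax-K _ _) · hyp p
⇒-intro (s5 p)            = s5 (ax-K _ _) · s5 p
⇒-intro (d · e)           = s5 (ax-S _ _ _) · ⇒-intro d · ⇒-intro e

¬¬-intro : ∀ {φ} → [] ⊢ φ ⇒ₘ (¬ₘ ¬ₘ φ)
¬¬-intro = ⇒-intro (⇒-intro (#0 · #1))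

¬¬-elim : ∀ {Γ φ} → Γ ⊢ ¬ₘ ¬ₘ φ → Γ ⊢ φ
¬¬-elim d = s5 (ax-DN _) · d

ex-falso : ∀ {Γ φ} → Γ ⊢ ⊥ₘ → Γ ⊢ φ
ex-falso d = ¬¬-elim (s5 (ax-K _ _) · d)

by-contradiction : ∀ {Γ φ} → ¬ₘ φ ∷ Γ ⊢ ⊥ₘ → Γ ⊢ φ
by-contradiction d = ¬¬-elim (⇒-intro d)

⊢-cases : ∀ {Γ φ ψ} → φ ∷ Γ ⊢ ψ → ¬ₘ φ ∷ Γ ⊢ ψ → Γ ⊢ ψ
⊢-cases {Γ} {φ} {ψ} d e = by-contradiction (#0 · (⊢-weaken₁ (⇒-intro e) · ¬φ))
  where
  ¬φ : ¬ₘ ψ ∷ Γ ⊢ ¬ₘ φ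
  ¬φ = ⇒-intro (#1 · ⊢-weaken (∷⁺ʳ φ there) d)

_∧ₘ_ : MFm → MFm → MFm
φ ∧ₘ ψ = ¬ₘ (φ ⇒ₘ (¬ₘ ψ))

∧-intro : ∀ {Γ φ ψ} → Γ ⊢ φ → Γ ⊢ ψ → Γ ⊢ φ ∧ₘ ψ
∧-intro d e = ⇒-intro (#0 · ⊢-weaken₁ d · ⊢-weaken₁ e)

∧-elimˡ : ∀ {Γ φ ψ} → Γ ⊢ φ ∧ₘ ψ → Γ ⊢ φ
∧-elimˡ d = by-contradiction (⊢-weaken₁ d · ⇒-intro (ex-falso (#1 · #0)))

∧-elimʳ : ∀ {Γ φ ψ} → Γ ⊢ φ ∧ₘ ψ → Γ ⊢ ψ
∧-elimʳ d = by-contradiction (⊢-weaken₁ d · ⇒-intro #1)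

⋀ : List MFm → MFm
⋀ []       = ¬ₘ ⊥ₘ
⋀ (φ ∷ φs) = φ ∧ₘ ⋀ φs

⋀-intro : ∀ {Γ φs} → (∀ {φ} → φ ∈ φs → Γ ⊢ φ) → Γ ⊢ ⋀ φs
⋀-intro {φs = []}    _    = s5 (S5-refl ⊥ₘ)
⋀-intro {φs = _ ∷ _} Γ⊢φs = ∧-intro (Γ⊢φs (here refl)) (⋀-intro (Γ⊢φs ∘ there))

⋀-elim : ∀ {Γ φ φs} → φ ∈ φs → Γ ⊢ ⋀ φs → Γ ⊢ φ
⋀-elim (here refl) d = ∧-elimˡ d
⋀-elim (there p)   d = ⋀-elim p (∧-elimʳ d)

⊢-nec : ∀ {Γ φ} → [] ⊢ φ → Γ ⊢ □ₘ φ
⊢-nec d = s5 (nec (closed⇒S5 d))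

infixl 5 _⊛_

_⊛_ : ∀ {Γ φ ψ} → Γ ⊢ □ₘ (φ ⇒ₘ ψ) → Γ ⊢ □ₘ φ → Γ ⊢ □ₘ ψ
d ⊛ e = s5 (ax-□K _ _) · d · e

□-map : ∀ {Γ φ ψ} → [] ⊢ φ ⇒ₘ ψ → Γ ⊢ □ₘ φ → Γ ⊢ □ₘ ψ
□-map d = ⊢-nec d ⊛_

□-T : ∀ {Γ φ} → Γ ⊢ □ₘ φ → Γ ⊢ φ
□-T d = s5 (ax-T _) · d

□-4 : ∀ {Γ φ} → Γ ⊢ □ₘ φ → Γ ⊢ □ₘ (□ₘ φ)
□-4 d = s5 (ax-4 _) · d

◇-intro : ∀ {Γ φ} → Γ ⊢ φ → Γ ⊢ ◇ₘ φ
◇-intro d = ⇒-intro (□-T #0 · ⊢-weaken₁ d)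

□◇-intro : ∀ {Γ φ} → Γ ⊢ φ → Γ ⊢ □ₘ (◇ₘ φ)
□◇-intro d = by-contradiction (s5 (ax-B (¬ₘ _)) · #0 · ⊢-weaken₁ d)

□-5 : ∀ {Γ φ} → Γ ⊢ ¬ₘ □ₘ φ → Γ ⊢ □ₘ (¬ₘ □ₘ φ)
□-5 d = □-map (⇒-intro (⇒-intro (#1 · □-map ¬¬-intro (□-4 #0)))) (□◇-intro d)

□-context : ∀ {Γ Δ φ} → (∀ {χ} → χ ∈ Δ → Γ ⊢ □ₘ χ) → Δ ⊢ φ → Γ ⊢ □ₘ φ
□-context {Δ = []}    _    d = ⊢-nec (⊢-weaken (λ ()) d)
□-context {Δ = _ ∷ _} Γ⊢□Δ d = □-context (Γ⊢□Δ ∘ there) (⇒-intro d) ⊛ Γ⊢□Δ (here refl)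

-- Kalmár's method

literal : Bool → MFm → MFm
literal true  φ = φ
literal false φ = ¬ₘ φ

literal-by-cases : ∀ {Γ φ} b → (T b → Γ ⊢ φ) → (¬ T b → Γ ⊢ ¬ₘ φ) →
                   Γ ⊢ literal b φ
literal-by-cases true  pos _   = pos tt
literal-by-cases false _   neg = neg id

literal-true : ∀ {Γ φ b} → T b → Γ ⊢ literal b φ → Γ ⊢ φ
literal-true {b = true} _ d = d

literal-false : ∀ {Γ φ b} → ¬ T b → Γ ⊢ literal b φ → Γ ⊢ ¬ₘ φ
literal-false {b = true}  ¬t _ = ⊥-elim (¬t tt)
literal-false {b = false} _  d = d

literal-⇒ : ∀ {Γ φ ψ} a b → Γ ⊢ literal a φ → Γ ⊢ literal b ψ →
            Γ ⊢ literal (not a ∨ b) (φ ⇒ₘ ψ)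
literal-⇒ false _     dφ _  = ⇒-intro (ex-falso (⊢-weaken₁ dφ · #0))
literal-⇒ true  true  _  dψ = ⇒-intro (⊢-weaken₁ dψ)
literal-⇒ true  false dφ dψ = ⇒-intro (⊢-weaken₁ dψ · (#0 · ⊢-weaken₁ dφ))

literals : ∀ {m} → Vec MFm m → Vec Bool m → List MFm
literals []       []       = []
literals (φ ∷ φs) (b ∷ bs) = literal b φ ∷ literals φs bs

∈-literals-map⁻ : ∀ {A : Set} {m χ} (f : A → MFm) (xs : Vec A m) bs →
                  χ ∈ literals (Vec.map f xs) bs → ∃₂ λ b x → χ ≡ literal b (f x)
∈-literals-map⁻ f []       []       ()
∈-literals-map⁻ f (x ∷ xs) (b ∷ bs) (here refl) = b , x , refl
∈-literals-map⁻ f (x ∷ xs) (b ∷ bs) (there p)   = ∈-literals-map⁻ f xs bs p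

selected : ∀ {A : Set} {m} → Vec A m → Vec Bool m → List A
selected []       []           = []
selected (x ∷ xs) (true  ∷ bs) = x ∷ selected xs bs
selected (x ∷ xs) (false ∷ bs) = selected xs bs

selected-literal : ∀ {A : Set} {m x} (f : A → MFm) (xs : Vec A m) bs →
                   x ∈ selected xs bs → f x ∈ literals (Vec.map f xs) bs
selected-literal f []       []           ()
selected-literal f (x ∷ xs) (true  ∷ bs) (here refl) = here refl
selected-literal f (x ∷ xs) (true  ∷ bs) (there p)   = there (selected-literal f xs bs p)
selected-literal f (x ∷ xs) (false ∷ bs) p           = there (selected-literal f xs bs p)

selected-or-¬literal : ∀ {A : Set} {m x} (f : A → MFm) {xs : Vec A m} bs →
                     x ∈ᵥ xs → x ∈ selected xs bs ⊎ ¬ₘ f x ∈ literals (Vec.map f xs) bs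
selected-or-¬literal f (true  ∷ bs) (here refl) = inj₁ (here refl)
selected-or-¬literal f (false ∷ bs) (here refl) = inj₂ (here refl)
selected-or-¬literal f (true  ∷ bs) (there p)   = Sum.map there there (selected-or-¬literal f bs p)
selected-or-¬literal f (false ∷ bs) (there p)   = Sum.map id there (selected-or-¬literal f bs p)

⊢-split-or-find : ∀ {m} (φs : Vec MFm m) {Γ ψ} {R : Vec Bool m → Set} →
                  (∀ bs → literals φs bs ++ Γ ⊢ ψ ⊎ R bs) → Γ ⊢ ψ ⊎ ∃ R
⊢-split-or-find []       h = Sum.map₂ ([] ,_) (h [])
⊢-split-or-find (φ ∷ φs) {Γ} h
  with ⊢-split-or-find φs (λ bs → Sum.map₁ (⊢-weaken (shifted bs)) (h (true ∷ bs)))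
     | ⊢-split-or-find φs (λ bs → Sum.map₁ (⊢-weaken (shifted bs)) (h (false ∷ bs)))
  where
  shifted : ∀ {b} bs → literal b φ ∷ literals φs bs ++ Γ ⊆ literals φs bs ++ literal b φ ∷ Γ
  shifted {b} bs = ⊆-reflexive-↭ (↭-sym (shift (literal b φ) (literals φs bs) Γ))
... | inj₁ d₁        | inj₁ d₂        = inj₁ (⊢-cases d₁ d₂)
... | inj₂ (bs , r)  | _              = inj₂ (true ∷ bs , r)
... | inj₁ _         | inj₂ (bs , r)  = inj₂ (false ∷ bs , r)

⊢-split : ∀ {m} (φs : Vec MFm m) {Γ ψ} → (∀ bs → literals φs bs ++ Γ ⊢ ψ) → Γ ⊢ ψ
⊢-split φs h = fromInj₁ (λ ()) (⊢-split-or-find φs {R = λ _ → ⊥} (inj₁ ∘ h))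

Valuation : ℕ → Set
Valuation = Vec Bool

infixl 9 _‼_

-- Junk value false beyond the length of the valuation; VarsBelow rules this case out.
_‼_ : ∀ {n} → Valuation n → ℕ → Bool
[]      ‼ _     = false
(b ∷ _) ‼ zero  = b
(_ ∷ v) ‼ suc i = v ‼ i

valuations : ∀ n → List (Valuation n)
valuations zero    = [ [] ]
valuations (suc n) = map (true ∷_) (valuations n) ++ map (false ∷_) (valuations n)

∈-valuations : ∀ {n} (v : Valuation n) → v ∈ valuations n
∈-valuations []          = here refl
∈-valuations (true  ∷ v) = ∈-++⁺ˡ (∈-map⁺ (true ∷_) (∈-valuations v))
∈-valuations (false ∷ v) = ∈-++⁺ʳ _ (∈-map⁺ (false ∷_) (∈-valuations v))

variablesFrom : ℕ → ∀ n → Vec MFm n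
variablesFrom k zero    = []
variablesFrom k (suc n) = pvar k ∷ variablesFrom (suc k) n

literal-variable∈ : ∀ {n i} k (v : Valuation n) → i < n →
                    literal (v ‼ i) (pvar (k + i)) ∈ literals (variablesFrom k n) v
literal-variable∈ {i = zero}  k (b ∷ v) _ rewrite +-identityʳ k = here refl
literal-variable∈ {i = suc i} k (b ∷ v) (s≤s i<n) rewrite +-suc k i =
  there (literal-variable∈ (suc k) v i<n)

diagram : ∀ {n} → Valuation n → List MFm
diagram v = literals (variablesFrom 0 _) v

char : ∀ {n} → Valuation n → MFm
char v = ⋀ (diagram v)

□-by-valuations : ∀ {Γ φ} n → (∀ (w : Valuation n) → Γ ⊢ □ₘ (char w ⇒ₘ φ)) →
                  Γ ⊢ □ₘ φ
□-by-valuations {φ = φ} n Γ⊢□ = □-context necessary (⊢-split (variablesFrom 0 n) by-diagram)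
  where
  cases : List MFm
  cases = map (λ w → char w ⇒ₘ φ) (valuations n)
  by-diagram : ∀ w → diagram w ++ cases ⊢ φ
  by-diagram w = hyp (∈-++⁺ʳ _ (∈-map⁺ _ (∈-valuations w))) · ⋀-intro (hyp ∘ ∈-++⁺ˡ)
  necessary : ∀ {χ} → χ ∈ cases → _ ⊢ □ₘ χ
  necessary p with ∈-map⁻ _ p
  ... | w , _ , refl = Γ⊢□ w

VarsBelow : ℕ → MFm → Set
VarsBelow n (pvar i) = i < n
VarsBelow n ⊥ₘ       = ⊤
VarsBelow n (φ ⇒ₘ ψ) = VarsBelow n φ × VarsBelow n ψ
VarsBelow n (□ₘ φ)   = VarsBelow n φ

varBound : MFm → ℕ
varBound (pvar i) = suc i
varBound ⊥ₘ       = 0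
varBound (φ ⇒ₘ ψ) = varBound φ ⊔ varBound ψ
varBound (□ₘ φ)   = varBound φ

varsBelow-varBound : ∀ φ {n} → varBound φ ≤ n → VarsBelow n φ
varsBelow-varBound (pvar i) le = le
varsBelow-varBound ⊥ₘ       _  = tt
varsBelow-varBound (φ ⇒ₘ ψ) le =
  varsBelow-varBound φ (≤-trans (m≤m⊔n _ _) le) ,
  varsBelow-varBound ψ (≤-trans (m≤n⊔m _ _) le)
varsBelow-varBound (□ₘ φ)   le = varsBelow-varBound φ le

-- Universal S5 models on a finite set of valuations

module Cluster {n : ℕ} (C : List (Valuation n)) where

  ⟦_⟧ : MFm → Valuation n → Bool
  ⟦ pvar i ⟧ v = v ‼ i
  ⟦ ⊥ₘ ⟧     _ = false
  ⟦ φ ⇒ₘ ψ ⟧ v = not (⟦ φ ⟧ v) ∨ ⟦ ψ ⟧ v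
  ⟦ □ₘ φ ⟧   _ = all ⟦ φ ⟧ C

T-all-lookup : ∀ {A : Set} {p : A → Bool} {x} xs → T (all p xs) → x ∈ xs → T (p x)
T-all-lookup xs t = All.lookup (all⁺ _ xs t)

¬T-all-counterexample : ∀ {A : Set} {p : A → Bool} xs → ¬ T (all p xs) →
                        ∃ λ x → x ∈ xs × ¬ T (p x)
¬T-all-counterexample {p = p} xs ¬t = find (¬All⇒Any¬ (T? ∘ p) xs (¬t ∘ all⁻ p))

reflects-true : ∀ {ℓ} {P : Set ℓ} {b} → Reflects P b → T b → P
reflects-true (ofʸ p) _ = p

reflects-false : ∀ {ℓ} {P : Set ℓ} {b} → Reflects P b → ¬ T b → ¬ P
reflects-false (ofʸ p)  ¬t = ⊥-elim (¬t tt)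
reflects-false (ofⁿ ¬p) _  = ¬p

reflects-by-cases : ∀ {ℓ} {P : Set ℓ} b → (T b → P) → (¬ T b → ¬ P) → Reflects P b
reflects-by-cases true  p _  = ofʸ (p tt)
reflects-by-cases false _ ¬p = ofⁿ (¬p id)

◇char : ∀ {n} → Valuation n → MFm
◇char w = ◇ₘ char w

module Diagram {n m : ℕ} (ws : Vec (Valuation n) m) (ws-complete : ∀ w → w ∈ᵥ ws)
               (S : Vec Bool m) where

  C : List (Valuation n)
  C = selected ws S

  open Cluster C

  M : List MFm
  M = literals (Vec.map ◇char ws) S

  Θ : Valuation n → List MFm
  Θ v = diagram v ++ M

  M-necessary : ∀ {χ} → χ ∈ M → M ⊢ □ₘ χ
  M-necessary p with ∈-literals-map⁻ ◇char ws S p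
  ... | true  , w , refl = □-5 (hyp p)
  ... | false , w , refl = □-map ¬¬-intro (□-4 (¬¬-elim (hyp p)))

  diagram-nec : ∀ {w φ} → Θ w ⊢ φ → M ⊢ □ₘ (char w ⇒ₘ φ)
  diagram-nec d = □-context M-necessary (⇒-intro (⊢-cut from-char d))
    where
    from-char : ∀ {χ} → χ ∈ Θ _ → _ ⊢ χ
    from-char p with ∈-++⁻ _ p
    ... | inj₁ q = ⋀-elim q #0
    ... | inj₂ q = hyp (there q)

  truth : ∀ φ → VarsBelow n φ → ∀ v → Θ v ⊢ literal (⟦ φ ⟧ v) φ
  truth (pvar i) i<n       v = hyp (∈-++⁺ˡ (literal-variable∈ 0 v i<n))
  truth ⊥ₘ       _         v = s5 (S5-refl ⊥ₘ)
  truth (φ ⇒ₘ ψ) (bφ , bψ) v = literal-⇒ (⟦ φ ⟧ v) (⟦ ψ ⟧ v) (truth φ bφ v) (truth ψ bψ v)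
  truth (□ₘ φ)   bφ        v =
    ⊢-weaken (xs⊆ys++xs M (diagram v)) (literal-by-cases (all ⟦ φ ⟧ C) necessary possible)
    where
    necessary : T (all ⟦ φ ⟧ C) → M ⊢ □ₘ φ
    necessary t = □-by-valuations n λ w → case w (selected-or-¬literal ◇char S (ws-complete w))
      where
      case : ∀ w → w ∈ C ⊎ ¬ₘ ◇char w ∈ M → M ⊢ □ₘ (char w ⇒ₘ φ)
      case w (inj₁ w∈C)  = diagram-nec (literal-true (T-all-lookup C t w∈C) (truth φ bφ w))
      case w (inj₂ ¬◇∈M) =
        □-map (⇒-intro (⇒-intro (ex-falso (#1 · #0)))) (¬¬-elim (hyp ¬◇∈M))
    possible : ¬ T (all ⟦ φ ⟧ C) → M ⊢ ¬ₘ □ₘ φ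
    possible ¬t with ¬T-all-counterexample C ¬t
    ... | u , u∈C , ¬φu =
      ⇒-intro (hyp (there (selected-literal ◇char ws S u∈C)) · (□-map contrapose □[char⇒¬φ] ⊛ #0))
      where
      □[char⇒¬φ] : □ₘ φ ∷ M ⊢ □ₘ (char u ⇒ₘ (¬ₘ φ))
      □[char⇒¬φ] = ⊢-weaken₁ (diagram-nec (literal-false ¬φu (truth φ bφ u)))
      contrapose : [] ⊢ (char u ⇒ₘ (¬ₘ φ)) ⇒ₘ (φ ⇒ₘ (¬ₘ char u))
      contrapose = ⇒-intro (⇒-intro (⇒-intro (#2 · #0 · #1)))

  prove-or-refute : ∀ ψ → VarsBelow n ψ → ∀ v → Θ v ⊢ ψ ⊎ (v ∈ C × ⟦ ψ ⟧ v ≡ false)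
  prove-or-refute ψ bψ v with ⟦ ψ ⟧ v | truth ψ bψ v
  ... | true  | d = inj₁ d
  ... | false | _ with selected-or-¬literal ◇char S (ws-complete v)
  ...   | inj₁ v∈C  = inj₂ (v∈C , refl)
  ...   | inj₂ ¬◇∈M = inj₁ (ex-falso (hyp (∈-++⁺ʳ _ ¬◇∈M) · ◇-intro char-v))
    where
    char-v : Θ v ⊢ char v
    char-v = ⋀-intro (hyp ∘ ∈-++⁺ˡ)

record Countermodel (ψ : MFm) : Set where
  field
    {n}           : ℕ
    cluster       : List (Valuation n)
    world         : Valuation n
    world∈cluster : world ∈ cluster
    refutes       : Cluster.⟦_⟧ cluster ψ world ≡ false

S5-or-countermodel : ∀ ψ → S5 ψ ⊎ Countermodel ψ
S5-or-countermodel ψ =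
  Sum.map closed⇒S5 countermodel (⊢-split-or-find (Vec.map ◇char worlds) per-cluster)
  where
  n = varBound ψ
  worlds : Vec (Valuation n) _
  worlds = Vec.fromList (valuations n)
  module D = Diagram worlds (∈-fromList⁺ ∘ ∈-valuations)
  Refuted : Vec Bool _ → Set
  Refuted S = ∃ λ v → v ∈ D.C S × Cluster.⟦_⟧ (D.C S) ψ v ≡ false
  per-cluster : ∀ S → D.M S ++ [] ⊢ ψ ⊎ Refuted S
  per-cluster S = Sum.map₁ (⊢-weaken (xs⊆xs++ys _ []))
    (⊢-split-or-find (variablesFrom 0 n) (D.prove-or-refute S ψ (varsBelow-varBound ψ ≤-refl)))
  countermodel : ∃ Refuted → Countermodel ψ
  countermodel (S , v , v∈C , fails) =
    record { cluster = D.C S ; world = v ; world∈cluster = v∈C ; refutes = fails }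

idᴹ : ∀ {U} → Mono U U
idᴹ = record { fun = id ; mono = id }

_∘ᴹ_ : ∀ {U V X} → Mono V X → Mono U V → Mono U X
g ∘ᴹ f = record { fun = fun g ∘ fun f ; mono = mono g ∘ mono f }

constᴹ : ∀ {U} (V : LinOrd) → Carrier V → Mono U V
constᴹ V c = record { fun = λ _ → c ; mono = λ _ → IsTotalOrder.refl (isTotalOrder V) }

Fin-order : ℕ → LinOrd
Fin-order s = record { Carrier = Fin s ; _≤_ = Fin._≤_ ; isTotalOrder = Fin-≤-isTotalOrder }

module _ {A : Set} where

  Sat-stable : ∀ {n} U κ ν (φ : Fm A n) → ¬ ¬ Sat U κ ν φ → Sat U κ ν φ
  Sat-stable U κ ν (s ≤ᶠ t) ¬¬sat = lift λ ¬s≤t → ¬¬sat λ s≤t → lower s≤t ¬s≤t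
  Sat-stable U κ ν (s ≈ᶠ t) ¬¬sat = lift λ ¬s≈t → ¬¬sat λ s≈t → lower s≈t ¬s≈t
  Sat-stable U κ ν ⊥ᶠ       ¬¬sat = lift (¬¬sat lower)
  Sat-stable U κ ν (φ ⇒ᶠ ψ) ¬¬sat = λ sφ →
    Sat-stable U κ ν ψ λ ¬sψ → ¬¬sat λ sφ⇒ψ → ¬sψ (sφ⇒ψ sφ)
  Sat-stable U κ ν (∀ᶠ φ)   ¬¬sat = λ x →
    Sat-stable U κ (extend x ν) φ λ ¬sx → ¬¬sat λ s∀ → ¬sx (s∀ x)
  Sat-stable U κ ν (□ᶠ φ)   ¬¬sat = λ V f →
    Sat-stable V (fun f ∘ κ) (fun f ∘ ν) φ λ ¬sf → ¬¬sat λ s□ → ¬sf (s□ V f)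

  evalT-cong : ∀ {n} U {κ κ′ : A → Carrier U} {ν ν′ : Fin n → Carrier U} →
               κ ≗ κ′ → ν ≗ ν′ → ∀ t → evalT U κ ν t ≡ evalT U κ′ ν′ t
  evalT-cong U κ≗ ν≗ (var i)   = ν≗ i
  evalT-cong U κ≗ ν≗ (const a) = κ≗ a

  extend-cong : ∀ {X : Set} {n} (x : X) {ν ν′ : Fin n → X} → ν ≗ ν′ →
                extend x ν ≗ extend x ν′
  extend-cong x ν≗ zero    = refl
  extend-cong x ν≗ (suc i) = ν≗ i

  Sat-cong : ∀ {n} U {κ κ′ : A → Carrier U} {ν ν′ : Fin n → Carrier U} →
             κ ≗ κ′ → ν ≗ ν′ → ∀ φ → Sat U κ ν φ → Sat U κ′ ν′ φ
  Sat-cong U κ≗ ν≗ (s ≤ᶠ t) (lift ¬¬s≤t) = lift λ ¬s≤t →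
    ¬¬s≤t (¬s≤t ∘ subst₂ (_≤ᴸ_ U) (evalT-cong U κ≗ ν≗ s) (evalT-cong U κ≗ ν≗ t))
  Sat-cong U κ≗ ν≗ (s ≈ᶠ t) (lift ¬¬s≈t) = lift λ ¬s≈t →
    ¬¬s≈t (¬s≈t ∘ subst₂ _≡_ (evalT-cong U κ≗ ν≗ s) (evalT-cong U κ≗ ν≗ t))
  Sat-cong U κ≗ ν≗ ⊥ᶠ       sat = sat
  Sat-cong U κ≗ ν≗ (φ ⇒ᶠ ψ) sat =
    Sat-cong U κ≗ ν≗ ψ ∘ sat ∘ Sat-cong U (sym ∘ κ≗) (sym ∘ ν≗) φ
  Sat-cong U κ≗ ν≗ (∀ᶠ φ)   sat = λ x → Sat-cong U κ≗ (extend-cong x ν≗) φ (sat x)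
  Sat-cong U κ≗ ν≗ (□ᶠ φ)   sat = λ V f →
    Sat-cong V (cong (fun f) ∘ κ≗) (cong (fun f) ∘ ν≗) φ (sat V f)

  ⊤ᶠ : ∀ {n} → Fm A n
  ⊤ᶠ = ¬ᶠ ⊥ᶠ

  _∧ᶠ_ : ∀ {n} → Fm A n → Fm A n → Fm A n
  φ ∧ᶠ ψ = ¬ᶠ (φ ⇒ᶠ (¬ᶠ ψ))

  ∃ᶠ : ∀ {n} → Fm A (suc n) → Fm A n
  ∃ᶠ φ = ¬ᶠ (∀ᶠ (¬ᶠ φ))

  _<ᶠ_ : ∀ {n} → Term A n → Term A n → Fm A n
  s <ᶠ t = ¬ᶠ (t ≤ᶠ s)

  if_then_else_ : ∀ {n} → Fm A n → Fm A n → Fm A n → Fm A n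
  if φ then ψ else χ = (φ ⇒ᶠ ψ) ∧ᶠ ((¬ᶠ φ) ⇒ᶠ χ)

  bool : ∀ {n} → Bool → Fm A n
  bool true  = ⊤ᶠ
  bool false = ⊥ᶠ

  ChainAbove : ∀ {n} → ℕ → Fm A (suc n)
  ChainAbove zero    = ⊤ᶠ
  ChainAbove (suc k) = ∃ᶠ ((var (suc zero) <ᶠ var zero) ∧ᶠ ChainAbove k)

  -- AtMost k expresses |U| ≤ k: no x starts a chain x < y₁ < … < y_k.
  AtMost : ∀ {n} → ℕ → Fm A n
  AtMost k = ∀ᶠ (¬ᶠ ChainAbove k)

  -- Sat U κ ν (s <ᶠ t) in unfolded form: Sat computes, so its arguments cannot be
  -- inferred from a folded type (hence also the explicit arguments below).
  Sat-<ᶠ⁺ : ∀ {P : Set} → ¬ P → Lift (lsuc 0ℓ) (¬ ¬ P) → Lift (lsuc 0ℓ) ⊥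
  Sat-<ᶠ⁺ ¬p (lift ¬¬p) = lift (¬¬p ¬p)

  Sat-<ᶠ⁻ : ∀ {P : Set} → (Lift (lsuc 0ℓ) (¬ ¬ P) → Lift (lsuc 0ℓ) ⊥) → ¬ P
  Sat-<ᶠ⁻ ¬atom p = lower (¬atom (lift λ ¬p → ¬p p))

  module Satisfaction {n : ℕ} (U : LinOrd) (κ : A → Carrier U) (ν : Fin n → Carrier U) where

    bool-reflects : ∀ b → Reflects (Sat U κ ν (bool b)) b
    bool-reflects true  = ofʸ id
    bool-reflects false = ofⁿ lower

    if-reflectsᵗ : ∀ φ {ψ χ b} → Sat U κ ν φ → Reflects (Sat U κ ν ψ) b →
                   Reflects (Sat U κ ν (if φ then ψ else χ)) b
    if-reflectsᵗ _ sφ (ofʸ sψ)  = ofʸ λ ¬if → ¬if (λ _ → sψ) (⊥-elim ∘ lower ∘ (_$ sφ))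
    if-reflectsᵗ _ sφ (ofⁿ ¬sψ) = ofⁿ λ sif → lower (sif λ φ⇒ψ _ → lift (¬sψ (φ⇒ψ sφ)))

    if-reflectsᶠ : ∀ φ {ψ χ b} → ¬ Sat U κ ν φ → Reflects (Sat U κ ν χ) b →
                   Reflects (Sat U κ ν (if φ then ψ else χ)) b
    if-reflectsᶠ _ ¬sφ (ofʸ sχ)  = ofʸ λ ¬if → ¬if (⊥-elim ∘ ¬sφ) (λ _ → sχ)
    if-reflectsᶠ _ ¬sφ (ofⁿ ¬sχ) =
      ofⁿ λ sif → lower (sif λ _ ¬φ⇒χ → lift (¬sχ (¬φ⇒χ (⊥-elim ∘ ¬sφ))))

    subsingleton-atMost1 : (∀ (x y : Carrier U) → x ≡ y) → Sat U κ ν (AtMost 1)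
    subsingleton-atMost1 same x chain =
      chain λ y x<y∧⊤ → x<y∧⊤ λ x<y _ → lift (Sat-<ᶠ⁻ x<y (reflexive (same y x)))
      where open IsTotalOrder (isTotalOrder U) using (reflexive)

  module _ {s : ℕ} {κ : A → Fin s} where
    open ≤-Reasoning

    chain-bound : ∀ {n} {ν : Fin (suc n) → Fin s} k →
                  Sat (Fin-order s) κ ν (ChainAbove k) → toℕ (ν zero) + k < s
    chain-bound {ν = ν} zero    _   = subst (_< s) (sym (+-identityʳ _)) (toℕ<n (ν zero))
    chain-bound {ν = ν} (suc k) sat =
      decidable-stable (toℕ (ν zero) + suc k <? s) λ out-of-bounds →
      lower (sat λ y x<y∧chain → x<y∧chain λ x<y chain → lift (out-of-bounds (begin-strict
        toℕ (ν zero) + suc k    ≡⟨ +-suc _ k ⟩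
        suc (toℕ (ν zero)) + k  ≤⟨ +-monoˡ-≤ k (≰⇒> (Sat-<ᶠ⁻ x<y)) ⟩
        toℕ y + k               <⟨ chain-bound k chain ⟩
        s                       ∎)))

    chain-exists : ∀ {n} {ν : Fin (suc n) → Fin s} k →
                   toℕ (ν zero) + k < s → Sat (Fin-order s) κ ν (ChainAbove k)
    chain-exists         zero    _     = id
    chain-exists {ν = ν} (suc k) bound =
      λ no-witness → no-witness y λ not-both → not-both (Sat-<ᶠ⁺ y≰x) (chain-exists k y+k<s)
      where
      x+1+k<s : suc (toℕ (ν zero)) + k < s
      x+1+k<s = subst (_< s) (+-suc _ k) bound
      y : Fin s
      y = fromℕ< (≤-<-trans (m≤m+n _ k) x+1+k<s)
      y≰x : ¬ toℕ y ≤ toℕ (ν zero)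
      y≰x y≤x = 1+n≰n (subst (_≤ toℕ (ν zero)) (toℕ-fromℕ< _) y≤x)
      y+k<s : toℕ y + k < s
      y+k<s = subst (λ m → m + k < s) (sym (toℕ-fromℕ< _)) x+1+k<s

  Fin-atMost : ∀ {s n k} {κ : A → Fin s} {ν : Fin n → Fin s} →
               s ≤ k → Sat (Fin-order s) κ ν (AtMost k)
  Fin-atMost {k = k} s≤k x chain =
    lift (<⇒≱ (chain-bound k chain) (≤-trans s≤k (m≤n+m k (toℕ x))))

  Fin-¬atMost : ∀ {s n k} {κ : A → Fin (suc s)} {ν : Fin n → Fin (suc s)} →
                k ≤ s → ¬ Sat (Fin-order (suc s)) κ ν (AtMost k)
  Fin-¬atMost {k = k} k≤s atMost = lower (atMost zero (chain-exists k (s≤s k≤s)))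

-- Realising a cluster countermodel in LO^mon

cascade : ∀ {A : Set} {n} → ℕ → Valuation n → List (Valuation n) → ℕ → Sentence A
cascade k u₀ []        i = bool (u₀ ‼ i)
cascade k u₀ (u₁ ∷ us) i = if AtMost k then bool (u₀ ‼ i) else cascade (suc k) u₁ us i

data Selects {A : Set} {n} (U : LinOrd) (κ : A → Carrier U) (ν : Fin 0 → Carrier U) :
             ℕ → Valuation n → List (Valuation n) → Valuation n → Set₁ where
  last  : ∀ {k u₀} → Selects U κ ν k u₀ [] u₀
  first : ∀ {k u₀ u₁ us} → Sat U κ ν (AtMost k) → Selects U κ ν k u₀ (u₁ ∷ us) u₀
  later : ∀ {k u₀ u₁ us u} → ¬ Sat U κ ν (AtMost k) → Selects U κ ν (suc k) u₁ us u →
          Selects U κ ν k u₀ (u₁ ∷ us) u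

module _ {A : Set} {n : ℕ} {U : LinOrd} {κ : A → Carrier U} {ν : Fin 0 → Carrier U} where

  open Satisfaction U κ ν

  cascade-reflects : ∀ {k} {u₀ u : Valuation n} {us} → Selects U κ ν k u₀ us u → ∀ i →
                     Reflects (Sat U κ ν (cascade k u₀ us i)) (u ‼ i)
  cascade-reflects {u₀ = u₀} last          i = bool-reflects (u₀ ‼ i)
  cascade-reflects {u₀ = u₀} (first small) i =
    if-reflectsᵗ (AtMost _) small (bool-reflects (u₀ ‼ i))
  cascade-reflects (later ¬small selects)  i =
    if-reflectsᶠ (AtMost _) ¬small (cascade-reflects selects i)

  selects-first : ∀ {k} {u₀ : Valuation n} us → Sat U κ ν (AtMost k) →
                  Selects U κ ν k u₀ us u₀
  selects-first []      _     = last
  selects-first (_ ∷ _) small = first small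

  selects-someone : ∀ k (u₀ : Valuation n) us →
                    ¬ ¬ ∃ λ u → u ∈ u₀ ∷ us × Selects U κ ν k u₀ us u
  selects-someone k u₀ []        none = none (u₀ , here refl , last)
  selects-someone k u₀ (u₁ ∷ us) none =
    selects-someone (suc k) u₁ us λ (u , u∈ , selects) →
      none (u , there u∈ , later ¬small selects)
    where
    ¬small : ¬ Sat U κ ν (AtMost k)
    ¬small small = none (u₀ , here refl , first small)

selected-by-Fin-order : ∀ {A : Set} {n} k (u₀ : Valuation n) us {u} → u ∈ u₀ ∷ us →
                        ∃ λ s → k ≤ s × ∀ (κ : A → Fin (suc s)) ν →
                                           Selects (Fin-order (suc s)) κ ν (suc k) u₀ us u
selected-by-Fin-order k u₀ []        (here refl) = k , ≤-refl , λ _ _ → last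
selected-by-Fin-order k u₀ (u₁ ∷ us) (here refl) = k , ≤-refl , λ _ _ → first (Fin-atMost ≤-refl)
selected-by-Fin-order k u₀ (u₁ ∷ us) (there u∈) with selected-by-Fin-order (suc k) u₁ us u∈
... | s , 1+k≤s , selects =
  s , ≤-trans (n≤1+n k) 1+k≤s , λ κ ν → later (Fin-¬atMost 1+k≤s) (selects κ ν)

module Realization {A : Set} {n : ℕ} {C : List (Valuation n)} {v : Valuation n} (v∈C : v ∈ C) where

  open Cluster C

  σ : ℕ → Sentence A
  σ = cascade 1 v C

  inst-reflects : ∀ φ {U κ ν u} → Selects U κ ν 1 v C u →
                  Reflects (Sat U κ ν (inst σ φ)) (⟦ φ ⟧ u)
  inst-reflects (pvar i) selects = cascade-reflects selects i
  inst-reflects ⊥ₘ       _       = ofⁿ lower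
  inst-reflects (φ ⇒ₘ ψ) selects = inst-reflects φ selects →-reflects inst-reflects ψ selects
  inst-reflects (□ₘ φ) {U} {κ} {ν} _ = reflects-by-cases (all ⟦ φ ⟧ C) necessary possible
    where
    ∈-C : ∀ {u} → u ∈ v ∷ C → u ∈ C
    ∈-C (here refl) = v∈C
    ∈-C (there u∈C) = u∈C
    necessary : T (all ⟦ φ ⟧ C) → Sat U κ ν (inst σ (□ₘ φ))
    necessary t V f = Sat-stable V _ _ (inst σ φ) λ ¬sat →
      selects-someone 1 v C λ (u , u∈ , selects) →
        ¬sat (reflects-true (inst-reflects φ selects) (T-all-lookup C t (∈-C u∈)))
    possible : ¬ T (all ⟦ φ ⟧ C) → ¬ Sat U κ ν (inst σ (□ₘ φ))
    possible ¬t □sat with ¬T-all-counterexample C ¬t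
    ... | u , u∈C , ¬φu with selected-by-Fin-order 0 v C (there u∈C)
    ...   | s , _ , selects =
      reflects-false (inst-reflects φ (selects _ _)) ¬φu
                     (□sat (Fin-order (suc s)) (constᴹ _ zero))

module _ {A : Set} (a₀ : A) (a≡a₀ : ∀ a → a ≡ a₀) where

  S5-sound : ∀ {ψ} → S5 ψ → ∀ σ U (κ : A → Carrier U) ν → Sat U κ ν (inst σ ψ)
  S5-sound (ax-K φ ψ)   σ U κ ν = λ sφ _ → sφ
  S5-sound (ax-S φ ψ χ) σ U κ ν = λ sφ⇒ψ⇒χ sφ⇒ψ sφ → sφ⇒ψ⇒χ sφ (sφ⇒ψ sφ)
  S5-sound (ax-DN φ)    σ U κ ν = λ ¬¬sφ →
    Sat-stable U κ ν (inst σ φ) λ ¬sφ → lower (¬¬sφ (lift ∘ ¬sφ))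
  S5-sound (ax-□K φ ψ)  σ U κ ν = λ □φ⇒ψ □φ V f → □φ⇒ψ V f (□φ V f)
  S5-sound (ax-T φ)     σ U κ ν = λ □φ → □φ U idᴹ
  S5-sound (ax-4 φ)     σ U κ ν = λ □φ V f X g → □φ X (g ∘ᴹ f)
  S5-sound (ax-B φ)     σ U κ ν = λ ◇□φ →
    Sat-stable U κ ν (inst σ φ) λ ¬sφ → lower (◇□φ λ V f □φ → lift (¬sφ (back V f □φ)))
    where
    back : ∀ V (f : Mono U V) → Sat V (fun f ∘ κ) (fun f ∘ ν) (□ᶠ (inst σ φ)) →
           Sat U κ ν (inst σ φ)
    back V f □φ = Sat-cong U (cong κ ∘ sym ∘ a≡a₀) (λ ()) (inst σ φ) (□φ U (constᴹ U (κ a₀)))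
  S5-sound (mp d e)     σ U κ ν = S5-sound d σ U κ ν (S5-sound e σ U κ ν)
  S5-sound (nec d)      σ U κ ν = λ V f → S5-sound d σ V (fun f ∘ κ) (fun f ∘ ν)

Val-sound : ∀ {W ψ} → IsSingleton W → S5 ψ → Val W ψ
Val-sound (w , x≡w) ⊢ψ σ = S5-sound w x≡w ⊢ψ σ _ id (λ ())

Val-refuted : ∀ {W ψ} → IsSingleton W → Countermodel ψ → ¬ Val W ψ
Val-refuted {W} {ψ} (w , x≡w) cm val = invert (subst (Reflects _) refutes W-reflects) (val σ)
  where
  open Countermodel cm
  open Realization {Carrier W} world∈cluster
  W-reflects : Reflects (W ⊨ inst σ ψ) (Cluster.⟦_⟧ cluster ψ world)
  W-reflects = inst-reflects ψ (selects-first cluster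
    (Satisfaction.subsingleton-atMost1 {n = 0} W id (λ ()) λ x y → trans (x≡w x) (sym (x≡w y))))

theorem7p4 : (W : LinOrd) → IsSingleton W →
    (ψ : MFm) → (Val W ψ → S5 ψ) × (S5 ψ → Val W ψ)
theorem7p4 W sing ψ = complete , Val-sound sing
  where
  complete : Val W ψ → S5 ψ
  complete val = fromInj₁ (λ cm → ⊥-elim (Val-refuted sing cm val)) (S5-or-countermodel ψ)
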